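{- Given an object $A$ of $\mathbf{C}$ and an operator $(-)^\sharp$ sending every morphism $f\colon X\to A+X$ to a morphism $f^\sharp\colon X\to A$, the pair $(A,(-)^\sharp)$ is an (unguarded) Elgot algebra if and only if $(-)^\sharp$ satisfies: (Fixpoint) for every $f\colon X\to A+X$, $f^\sharp=[\mathrm{id},f^\sharp]\circ f$; (Uniformity) for every $f\colon X\to A+X$, every $g\colon Y\to A+Y$ and every $h\colon X\to Y$, $(\mathrm{id}+h)\circ f=g\circ h$ implies $f^\sharp=g^\sharp\circ h$; (Folding) for every $h\colon Y\to X+Y$ and $f\colon X\to A+X$, $(f^\sharp+h)^\sharp=[(\mathrm{id}+\mathrm{inl})\circ f,\ \mathrm{inr}\circ h]^\sharp$ (both sides being morphisms $X+Y\to A$).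
   Context: $\mathbf{C}$ is an extensive category with finite products, a stable natural number object and exponentials $X^{\mathbb{N}}$. An (unguarded) Elgot algebra is a pair $(A,(-)^\sharp)$ where $(-)^\sharp$ assigns to every $f\colon X\to A+X$ a morphism $f^\sharp\colon X\to A$ such that: (Fixpoint) $f^\sharp=[\mathrm{id},f^\sharp]\circ f$; (Uniformity) for $f\colon X\to A+X$, $g\colon Y\to A+Y$, $h\colon X\to Y$, $(\mathrm{id}+h)\circ f=g\circ h$ implies $f^\sharp=g^\sharp\circ h$; (Compositionality) for every $h\colon Y\to X+Y$ and $f\colon X\to A+X$, $((f^\sharp+\mathrm{id})\circ h)^\sharp=\big([(\mathrm{id}+\mathrm{inl})\circ f,\ \mathrm{inr}\circ\mathrm{inr}]\circ[\mathrm{inl},h]\colon X+Y\to A+(X+Y)\big)^\sharp\circ\mathrm{inr}$. (Equivalently, these are the $\mathrm{Id}$-guarded Elgot algebras whose $\mathrm{Id}$-algebra structure $A\to A$ is the identity.) Here $[\,\cdot,\cdot\,]$ denotes copairing and $\mathrm{inl},\mathrm{inr}$ the coproduct injections. -}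

module Defs where

open import Level using (Level; _⊔_; suc)
open import Relation.Binary using (Rel; IsEquivalence)
open import Data.Product using (Σ; _×_; _,_)
open import Function.Bundles using (_⇔_)

record Category (o ℓ e : Level) : Set (suc (o ⊔ ℓ ⊔ e)) where
  infixr 9 _∘_
  infix  4 _≈_
  infixr 1 _⇒_
  field
    Obj       : Set o
    _⇒_       : Obj → Obj → Set ℓ
    _≈_       : ∀ {A B} → Rel (A ⇒ B) e
    id        : ∀ {A} → A ⇒ A
    _∘_       : ∀ {A B C} → B ⇒ C → A ⇒ B → A ⇒ C
    assoc     : ∀ {A B C D} {f : A ⇒ B} {g : B ⇒ C} {h : C ⇒ D} →
                (h ∘ g) ∘ f ≈ h ∘ (g ∘ f)
    identityˡ : ∀ {A B} {f : A ⇒ B} → id ∘ f ≈ f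
    identityʳ : ∀ {A B} {f : A ⇒ B} → f ∘ id ≈ f
    equiv     : ∀ {A B} → IsEquivalence (_≈_ {A} {B})
    ∘-resp-≈  : ∀ {A B C} {f h : B ⇒ C} {g i : A ⇒ B} →
                f ≈ h → g ≈ i → f ∘ g ≈ h ∘ i

module Notions {o ℓ e : Level} (C : Category o ℓ e) where
  open Category C

  record Initial : Set (o ⊔ ℓ ⊔ e) where
    field
      ⊥        : Obj
      ¡        : ∀ {A} → ⊥ ⇒ A
      ¡-unique : ∀ {A} (f : ⊥ ⇒ A) → ¡ ≈ f

  record Terminal : Set (o ⊔ ℓ ⊔ e) where
    field
      ⊤        : Obj
      !        : ∀ {A} → A ⇒ ⊤
      !-unique : ∀ {A} (f : A ⇒ ⊤) → ! ≈ f

  record Coproduct (A B : Obj) : Set (o ⊔ ℓ ⊔ e) where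
    field
      A+B     : Obj
      i₁      : A ⇒ A+B
      i₂      : B ⇒ A+B
      [_,_]   : ∀ {Z} → A ⇒ Z → B ⇒ Z → A+B ⇒ Z
      inject₁ : ∀ {Z} {f : A ⇒ Z} {g : B ⇒ Z} → [ f , g ] ∘ i₁ ≈ f
      inject₂ : ∀ {Z} {f : A ⇒ Z} {g : B ⇒ Z} → [ f , g ] ∘ i₂ ≈ g
      unique  : ∀ {Z} {h : A+B ⇒ Z} {f : A ⇒ Z} {g : B ⇒ Z} →
                h ∘ i₁ ≈ f → h ∘ i₂ ≈ g → [ f , g ] ≈ h

  record Product (A B : Obj) : Set (o ⊔ ℓ ⊔ e) where
    field
      A×B      : Obj
      π₁       : A×B ⇒ A
      π₂       : A×B ⇒ B
      ⟨_,_⟩    : ∀ {Z} → Z ⇒ A → Z ⇒ B → Z ⇒ A×B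
      project₁ : ∀ {Z} {f : Z ⇒ A} {g : Z ⇒ B} → π₁ ∘ ⟨ f , g ⟩ ≈ f
      project₂ : ∀ {Z} {f : Z ⇒ A} {g : Z ⇒ B} → π₂ ∘ ⟨ f , g ⟩ ≈ g
      unique   : ∀ {Z} {h : Z ⇒ A×B} {f : Z ⇒ A} {g : Z ⇒ B} →
                 π₁ ∘ h ≈ f → π₂ ∘ h ≈ g → ⟨ f , g ⟩ ≈ h

  IsPullback : ∀ {P X Y Z} (p₁ : P ⇒ X) (p₂ : P ⇒ Y) (f : X ⇒ Z) (g : Y ⇒ Z) →
               Set (o ⊔ ℓ ⊔ e)
  IsPullback {P} {X} {Y} p₁ p₂ f g =
    (f ∘ p₁ ≈ g ∘ p₂) ×
    (∀ {Q} (h₁ : Q ⇒ X) (h₂ : Q ⇒ Y) → f ∘ h₁ ≈ g ∘ h₂ →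
       Σ (Q ⇒ P) λ u → (p₁ ∘ u ≈ h₁) × (p₂ ∘ u ≈ h₂) ×
         (∀ (v : Q ⇒ P) → p₁ ∘ v ≈ h₁ → p₂ ∘ v ≈ h₂ → v ≈ u))

  record Pullback {X Y Z} (f : X ⇒ Z) (g : Y ⇒ Z) : Set (o ⊔ ℓ ⊔ e) where
    field
      P          : Obj
      p₁         : P ⇒ X
      p₂         : P ⇒ Y
      isPullback : IsPullback p₁ p₂ f g

  IsCoproduct : ∀ {X₁ X₂ Z} (x₁ : X₁ ⇒ Z) (x₂ : X₂ ⇒ Z) → Set (o ⊔ ℓ ⊔ e)
  IsCoproduct {X₁} {X₂} {Z} x₁ x₂ =
    ∀ {W} (f : X₁ ⇒ W) (g : X₂ ⇒ W) →
      Σ (Z ⇒ W) λ u → (u ∘ x₁ ≈ f) × (u ∘ x₂ ≈ g) ×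
        (∀ (v : Z ⇒ W) → v ∘ x₁ ≈ f → v ∘ x₂ ≈ g → v ≈ u)

  -- Standing assumptions of the paper: C is extensive (Carboni–Lack–
  -- Walters: finite coproducts, pullbacks along coproduct injections, and
  -- a commuting diagram over A → A+B ← B has coproduct top row iff both
  -- squares are pullbacks), has finite products, a stable (parametrised)
  -- natural number object, and exponentials X^ℕ.

  record Standing : Set (o ⊔ ℓ ⊔ e) where
    field
      initial    : Initial
      coproduct  : ∀ A B → Coproduct A B
      terminal   : Terminal
      product    : ∀ A B → Product A B

    _+_ : Obj → Obj → Obj
    A + B = Coproduct.A+B (coproduct A B)

    _×ₒ_ : Obj → Obj → Obj
    A ×ₒ B = Product.A×B (product A B)

    inl : ∀ {A B} → A ⇒ A + B
    inl {A} {B} = Coproduct.i₁ (coproduct A B)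

    inr : ∀ {A B} → B ⇒ A + B
    inr {A} {B} = Coproduct.i₂ (coproduct A B)

    π₁ : ∀ {A B} → A ×ₒ B ⇒ A
    π₁ {A} {B} = Product.π₁ (product A B)

    π₂ : ∀ {A B} → A ×ₒ B ⇒ B
    π₂ {A} {B} = Product.π₂ (product A B)

    ⟨_,_⟩ : ∀ {Z A B} → Z ⇒ A → Z ⇒ B → Z ⇒ A ×ₒ B
    ⟨_,_⟩ {Z} {A} {B} = Product.⟨_,_⟩ (product A B)

    _⊗_ : ∀ {A B C D} → A ⇒ B → C ⇒ D → A ×ₒ C ⇒ B ×ₒ D
    f ⊗ g = ⟨ f ∘ π₁ , g ∘ π₂ ⟩

    field
      pullback-inl : ∀ {A B Z} (h : Z ⇒ A + B) → Pullback h inl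
      pullback-inr : ∀ {A B Z} (h : Z ⇒ A + B) → Pullback h inr
      extensive    : ∀ {A B X₁ X₂ Z}
                       (x₁ : X₁ ⇒ Z) (x₂ : X₂ ⇒ Z)
                       (h₁ : X₁ ⇒ A) (h : Z ⇒ A + B) (h₂ : X₂ ⇒ B) →
                       h ∘ x₁ ≈ inl ∘ h₁ → h ∘ x₂ ≈ inr ∘ h₂ →
                       (IsCoproduct x₁ x₂ ⇔
                         (IsPullback x₁ h₁ h inl × IsPullback x₂ h₂ h inr))
      ℕ     : Obj
      zero  : Terminal.⊤ terminal ⇒ ℕ
      succ  : ℕ ⇒ ℕ
      ℕ-rec : ∀ {X A} (f : X ⇒ A) (g : A ⇒ A) →
              Σ (X ×ₒ ℕ ⇒ A) λ h →
                (h ∘ ⟨ id , zero ∘ Terminal.! terminal ⟩ ≈ f) ×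
                (h ∘ (id ⊗ succ) ≈ g ∘ h) ×
                (∀ (k : X ×ₒ ℕ ⇒ A) →
                   k ∘ ⟨ id , zero ∘ Terminal.! terminal ⟩ ≈ f →
                   k ∘ (id ⊗ succ) ≈ g ∘ k → k ≈ h)
      _^ℕ   : Obj → Obj
      eval  : ∀ {X} → (X ^ℕ) ×ₒ ℕ ⇒ X
      curry : ∀ {X Y} (f : Y ×ₒ ℕ ⇒ X) →
              Σ (Y ⇒ X ^ℕ) λ λf → (eval ∘ (λf ⊗ id) ≈ f) ×
                (∀ (k : Y ⇒ X ^ℕ) → eval ∘ (k ⊗ id) ≈ f → k ≈ λf)

  module Elgot (cp : ∀ A B → Coproduct A B) where
    _+_ : Obj → Obj → Obj
    A + B = Coproduct.A+B (cp A B)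

    inl : ∀ {A B} → A ⇒ A + B
    inl {A} {B} = Coproduct.i₁ (cp A B)

    inr : ∀ {A B} → B ⇒ A + B
    inr {A} {B} = Coproduct.i₂ (cp A B)

    [_,_] : ∀ {A B Z} → A ⇒ Z → B ⇒ Z → A + B ⇒ Z
    [_,_] {A} {B} = Coproduct.[_,_] (cp A B)

    _⊕_ : ∀ {A B C D} → A ⇒ B → C ⇒ D → A + C ⇒ B + D
    f ⊕ g = [ inl ∘ f , inr ∘ g ]

    IterationOp : Obj → Set (o ⊔ ℓ)
    IterationOp A = ∀ {X} → X ⇒ A + X → X ⇒ A

    Fixpoint : ∀ {A} → IterationOp A → Set (o ⊔ ℓ ⊔ e)
    Fixpoint {A} _♯ = ∀ {X} (f : X ⇒ A + X) → f ♯ ≈ [ id , f ♯ ] ∘ f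

    Uniformity : ∀ {A} → IterationOp A → Set (o ⊔ ℓ ⊔ e)
    Uniformity {A} _♯ = ∀ {X Y} (f : X ⇒ A + X) (g : Y ⇒ A + Y) (h : X ⇒ Y) →
      (id ⊕ h) ∘ f ≈ g ∘ h → f ♯ ≈ g ♯ ∘ h

    Compositionality : ∀ {A} → IterationOp A → Set (o ⊔ ℓ ⊔ e)
    Compositionality {A} _♯ = ∀ {X Y} (h : Y ⇒ X + Y) (f : X ⇒ A + X) →
      (((f ♯) ⊕ id) ∘ h) ♯ ≈
        (([ (id ⊕ inl) ∘ f , inr ∘ inr ] ∘ [ inl , h ]) ♯) ∘ inr

    Folding : ∀ {A} → IterationOp A → Set (o ⊔ ℓ ⊔ e)
    Folding {A} _♯ = ∀ {X Y} (h : Y ⇒ X + Y) (f : X ⇒ A + X) →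
      ((f ♯) ⊕ h) ♯ ≈ [ (id ⊕ inl) ∘ f , inr ∘ h ] ♯

    record IsElgotAlgebra {A : Obj} (_♯ : IterationOp A) : Set (o ⊔ ℓ ⊔ e) where
      field
        fixpoint         : Fixpoint _♯
        uniformity       : Uniformity _♯
        compositionality : Compositionality _♯

module Submission where

-- Folding and Compositionality differ only by a reindexing of the state
-- space, which Uniformity licenses.  Both are iterations of a loop that runs
-- f on the X-summand and h on the Y-summand; in Compositionality the Y-part
-- is first unfolded once through [ inl , h ], and uniformity along
-- [ inl , h ] (resp. along [ inl , id ] for the converse) identifies the two
-- loops.

open import Defs
open import Data.Product using (_×_; _,_)
open import Function.Bundles using (_⇔_; mk⇔)
open import Relation.Binary using (IsEquivalence; Setoid)
import Relation.Binary.Reasoning.Setoid as SetoidReasoning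

module CoproductLaws {o ℓ e} (C : Category o ℓ e)
                     (cp : ∀ A B → Notions.Coproduct C A B) where
  open Category C
  open Notions C using (Coproduct)
  open Notions.Elgot C cp

  module ≈ {A B : Obj} = IsEquivalence (equiv {A} {B})

  hom-setoid : Obj → Obj → Setoid ℓ e
  hom-setoid A B = record { Carrier = A ⇒ B ; _≈_ = _≈_ ; isEquivalence = equiv }

  open module HomReasoning {A B : Obj} = SetoidReasoning (hom-setoid A B) public

  ∘-resp-≈ˡ : ∀ {A B D} {f h : B ⇒ D} {g : A ⇒ B} → f ≈ h → f ∘ g ≈ h ∘ g
  ∘-resp-≈ˡ p = ∘-resp-≈ p ≈.refl

  ∘-resp-≈ʳ : ∀ {A B D} {f : B ⇒ D} {g i : A ⇒ B} → g ≈ i → f ∘ g ≈ f ∘ i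
  ∘-resp-≈ʳ p = ∘-resp-≈ ≈.refl p

  inject₁ : ∀ {A B D} {f : A ⇒ D} {g : B ⇒ D} → [ f , g ] ∘ inl ≈ f
  inject₁ {A} {B} = Coproduct.inject₁ (cp A B)

  inject₂ : ∀ {A B D} {f : A ⇒ D} {g : B ⇒ D} → [ f , g ] ∘ inr ≈ g
  inject₂ {A} {B} = Coproduct.inject₂ (cp A B)

  +-ext : ∀ {A B D} {h k : A + B ⇒ D} → h ∘ inl ≈ k ∘ inl → h ∘ inr ≈ k ∘ inr → h ≈ k
  +-ext {A} {B} {h = h} {k} p q =
    ≈.trans (≈.sym (Coproduct.unique (cp A B) {h = h} ≈.refl ≈.refl))
            (Coproduct.unique (cp A B) {h = k} (≈.sym p) (≈.sym q))

  []-cong₂ : ∀ {A B D} {f f′ : A ⇒ D} {g g′ : B ⇒ D} →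
             f ≈ f′ → g ≈ g′ → [ f , g ] ≈ [ f′ , g′ ]
  []-cong₂ p q = +-ext (≈.trans inject₁ (≈.trans p (≈.sym inject₁)))
                       (≈.trans inject₂ (≈.trans q (≈.sym inject₂)))

  ⊕-cong₂ : ∀ {A B D E} {f f′ : A ⇒ B} {g g′ : D ⇒ E} → f ≈ f′ → g ≈ g′ → f ⊕ g ≈ f′ ⊕ g′
  ⊕-cong₂ p q = []-cong₂ (∘-resp-≈ʳ p) (∘-resp-≈ʳ q)

  ∘[] : ∀ {A B D E} {h : D ⇒ E} {f : A ⇒ D} {g : B ⇒ D} → h ∘ [ f , g ] ≈ [ h ∘ f , h ∘ g ]
  ∘[] = ≈.sym (+-ext (≈.trans inject₁ (≈.sym (≈.trans assoc (∘-resp-≈ʳ inject₁))))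
                     (≈.trans inject₂ (≈.sym (≈.trans assoc (∘-resp-≈ʳ inject₂)))))

  []∘⊕ : ∀ {A B D E F} {f : B ⇒ F} {g : E ⇒ F} {c : A ⇒ B} {d : D ⇒ E} →
         [ f , g ] ∘ (c ⊕ d) ≈ [ f ∘ c , g ∘ d ]
  []∘⊕ {f = f} {g} {c} {d} = begin
    [ f , g ] ∘ [ inl ∘ c , inr ∘ d ]                   ≈⟨ ∘[] ⟩
    [ [ f , g ] ∘ (inl ∘ c) , [ f , g ] ∘ (inr ∘ d) ]   ≈⟨ []-cong₂ (pull inject₁) (pull inject₂) ⟩
    [ f ∘ c , g ∘ d ]                                   ∎
    where
      pull : ∀ {A B D E} {x : B ⇒ D} {y : E ⇒ D} {z : E ⇒ B} {w : A ⇒ E} →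
             x ∘ z ≈ y → x ∘ (z ∘ w) ≈ y ∘ w
      pull p = ≈.trans (≈.sym assoc) (∘-resp-≈ˡ p)

  ⊕∘⊕ : ∀ {A B D E F G} {a : B ⇒ D} {b : F ⇒ G} {c : A ⇒ B} {d : E ⇒ F} →
        (a ⊕ b) ∘ (c ⊕ d) ≈ (a ∘ c) ⊕ (b ∘ d)
  ⊕∘⊕ = ≈.trans []∘⊕ ([]-cong₂ assoc assoc)

  ⊕-identity : ∀ {A B} → id {A} ⊕ id {B} ≈ id
  ⊕-identity = +-ext (≈.trans inject₁ (≈.trans identityʳ (≈.sym identityˡ)))
                     (≈.trans inject₂ (≈.trans identityʳ (≈.sym identityˡ)))

module ElgotLaws {o ℓ e} (C : Category o ℓ e)
                 (cp : ∀ A B → Notions.Coproduct C A B)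
                 {A : Category.Obj C} (_♯ : Notions.Elgot.IterationOp C cp A) where
  open Category C
  open Notions.Elgot C cp
  open CoproductLaws C cp

  ♯-resp-≈ : Uniformity _♯ → ∀ {X} {f g : X ⇒ A + X} → f ≈ g → f ♯ ≈ g ♯
  ♯-resp-≈ uniform {f = f} {g} f≈g = ≈.trans (uniform f g id square) identityʳ
    where
      square : (id ⊕ id) ∘ f ≈ g ∘ id
      square = ≈.trans (∘-resp-≈ˡ ⊕-identity)
                       (≈.trans identityˡ (≈.trans f≈g (≈.sym identityʳ)))

  -- Folding equates ((f ♯) ⊕ h) ♯ with merge f h ♯, and Compositionality
  -- iterates merge f inr ∘ [ inl , h ].
  merge : ∀ {X Y Z} → X ⇒ A + X → Y ⇒ X + Z → X + Y ⇒ A + (X + Z)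
  merge f h = [ (id ⊕ inl) ∘ f , inr ∘ h ]

  merge-cong₂ : ∀ {X Y Z} {f : X ⇒ A + X} {g h : Y ⇒ X + Z} → g ≈ h → merge f g ≈ merge f h
  merge-cong₂ g≈h = []-cong₂ ≈.refl (∘-resp-≈ʳ g≈h)

  merge∘⊕ : ∀ {X Y Z W} (f : X ⇒ A + X) {g : Z ⇒ X + W} {h : Y ⇒ Z} →
            merge f g ∘ (id ⊕ h) ≈ merge f (g ∘ h)
  merge∘⊕ f = ≈.trans []∘⊕ ([]-cong₂ identityʳ assoc)

  merge-reindex : ∀ {X Y Z} (f : X ⇒ A + X) {v : X + Y ⇒ X + Z} → v ∘ inl ≈ inl →
                  (id ⊕ v) ∘ merge f inr ≈ merge f (v ∘ inr)
  merge-reindex f {v} v∘inl≈inl = begin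
    (id ⊕ v) ∘ merge f inr                                     ≈⟨ ∘[] ⟩
    [ (id ⊕ v) ∘ ((id ⊕ inl) ∘ f) , (id ⊕ v) ∘ (inr ∘ inr) ]   ≈⟨ []-cong₂ on-X on-Y ⟩
    merge f (v ∘ inr)                                          ∎
    where
      on-X : (id ⊕ v) ∘ ((id ⊕ inl) ∘ f) ≈ (id ⊕ inl) ∘ f
      on-X = begin
        (id ⊕ v) ∘ ((id ⊕ inl) ∘ f)   ≈⟨ ≈.sym assoc ⟩
        ((id ⊕ v) ∘ (id ⊕ inl)) ∘ f   ≈⟨ ∘-resp-≈ˡ ⊕∘⊕ ⟩
        ((id ∘ id) ⊕ (v ∘ inl)) ∘ f   ≈⟨ ∘-resp-≈ˡ (⊕-cong₂ identityˡ v∘inl≈inl) ⟩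
        (id ⊕ inl) ∘ f                ∎
      on-Y : (id ⊕ v) ∘ (inr ∘ inr) ≈ inr ∘ (v ∘ inr)
      on-Y = begin
        (id ⊕ v) ∘ (inr ∘ inr)   ≈⟨ ≈.sym assoc ⟩
        ((id ⊕ v) ∘ inr) ∘ inr   ≈⟨ ∘-resp-≈ˡ inject₂ ⟩
        (inr ∘ v) ∘ inr          ≈⟨ assoc ⟩
        inr ∘ (v ∘ inr)          ∎

  ♯∘⊕ : Uniformity _♯ → ∀ {X Y} (f : X ⇒ A + X) (h : Y ⇒ X + Y) →
        (((f ♯) ⊕ id) ∘ h) ♯ ≈ ((f ♯) ⊕ h) ♯ ∘ h
  ♯∘⊕ uniform f h = uniform (((f ♯) ⊕ id) ∘ h) ((f ♯) ⊕ h) h square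
    where
      square : (id ⊕ h) ∘ (((f ♯) ⊕ id) ∘ h) ≈ ((f ♯) ⊕ h) ∘ h
      square = ≈.trans (≈.sym assoc) (∘-resp-≈ˡ (≈.trans ⊕∘⊕ (⊕-cong₂ identityˡ identityʳ)))

  uniformity+compositionality⇒folding :
    Uniformity _♯ → Compositionality _♯ → Folding _♯
  uniformity+compositionality⇒folding uniform compose {X} {Y} h f = begin
    ((f ♯) ⊕ h) ♯                                ≈⟨ ♯-resp-≈ uniform (≈.sym factor) ⟩
    (((f ♯) ⊕ id) ∘ (id ⊕ h)) ♯                  ≈⟨ compose (id ⊕ h) f ⟩
    (merge f inr ∘ [ inl , id ⊕ h ]) ♯ ∘ inr     ≈⟨ ∘-resp-≈ˡ (uniform _ _ collapse square) ⟩
    (merge f h ♯ ∘ collapse) ∘ inr               ≈⟨ assoc ⟩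
    merge f h ♯ ∘ (collapse ∘ inr)               ≈⟨ ∘-resp-≈ʳ inject₂ ⟩
    merge f h ♯ ∘ id                             ≈⟨ identityʳ ⟩
    merge f h ♯                                  ∎
    where
      collapse : X + (X + Y) ⇒ X + Y
      collapse = [ inl , id ]
      factor : ((f ♯) ⊕ id) ∘ (id ⊕ h) ≈ (f ♯) ⊕ h
      factor = ≈.trans ⊕∘⊕ (⊕-cong₂ identityʳ identityˡ)
      square : (id ⊕ collapse) ∘ (merge f inr ∘ [ inl , id ⊕ h ]) ≈ merge f h ∘ collapse
      square = begin
        (id ⊕ collapse) ∘ (merge f inr ∘ [ inl , id ⊕ h ])   ≈⟨ ≈.sym assoc ⟩
        ((id ⊕ collapse) ∘ merge f inr) ∘ [ inl , id ⊕ h ]   ≈⟨ ∘-resp-≈ˡ (merge-reindex f inject₁) ⟩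
        merge f (collapse ∘ inr) ∘ [ inl , id ⊕ h ]          ≈⟨ ∘-resp-≈ˡ (merge-cong₂ inject₂) ⟩
        merge f id ∘ [ inl , id ⊕ h ]                        ≈⟨ ∘[] ⟩
        [ merge f id ∘ inl , merge f id ∘ (id ⊕ h) ]         ≈⟨ []-cong₂ inject₁ (merge∘⊕ f) ⟩
        [ (id ⊕ inl) ∘ f , merge f (id ∘ h) ]                ≈⟨ []-cong₂ (≈.sym inject₁) (merge-cong₂ identityˡ) ⟩
        [ merge f h ∘ inl , merge f h ]                      ≈⟨ []-cong₂ ≈.refl (≈.sym identityʳ) ⟩
        [ merge f h ∘ inl , merge f h ∘ id ]                 ≈⟨ ≈.sym ∘[] ⟩
        merge f h ∘ collapse                                 ∎

  uniformity+folding⇒compositionality :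
    Uniformity _♯ → Folding _♯ → Compositionality _♯
  uniformity+folding⇒compositionality uniform fold {X} {Y} h f = begin
    (((f ♯) ⊕ id) ∘ h) ♯                   ≈⟨ ♯∘⊕ uniform f h ⟩
    ((f ♯) ⊕ h) ♯ ∘ h                      ≈⟨ ∘-resp-≈ˡ (fold h f) ⟩
    merge f h ♯ ∘ h                        ≈⟨ ∘-resp-≈ʳ (≈.sym inject₂) ⟩
    merge f h ♯ ∘ (unfold ∘ inr)           ≈⟨ ≈.sym assoc ⟩
    (merge f h ♯ ∘ unfold) ∘ inr           ≈⟨ ∘-resp-≈ˡ (≈.sym (uniform _ _ unfold square)) ⟩
    (merge f inr ∘ unfold) ♯ ∘ inr         ∎
    where
      unfold : X + Y ⇒ X + Y
      unfold = [ inl , h ]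
      square : (id ⊕ unfold) ∘ (merge f inr ∘ unfold) ≈ merge f h ∘ unfold
      square = ≈.trans (≈.sym assoc)
                 (∘-resp-≈ˡ (≈.trans (merge-reindex f inject₁) (merge-cong₂ inject₂)))

proposition4p4 : ∀ {o ℓ e} (C : Category o ℓ e) (S : Notions.Standing C)
                   (A : Category.Obj C)
                   (_♯ : Notions.Elgot.IterationOp C (Notions.Standing.coproduct S) A) →
                   let open Notions.Elgot C (Notions.Standing.coproduct S) in
                   IsElgotAlgebra _♯ ⇔ (Fixpoint _♯ × Uniformity _♯ × Folding _♯)
proposition4p4 C S A _♯ = mk⇔ to from
  where
    open Notions.Elgot C (Notions.Standing.coproduct S)
    open ElgotLaws C (Notions.Standing.coproduct S) _♯
    to : IsElgotAlgebra _♯ → Fixpoint _♯ × Uniformity _♯ × Folding _♯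
    to elgot = fixpoint , uniformity , uniformity+compositionality⇒folding uniformity compositionality
      where open IsElgotAlgebra elgot
    from : Fixpoint _♯ × Uniformity _♯ × Folding _♯ → IsElgotAlgebra _♯
    from (fixpoint , uniform , fold) = record
      { fixpoint         = fixpoint
      ; uniformity       = uniform
      ; compositionality = uniformity+folding⇒compositionality uniform fold
      }
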